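{- Let $k<0$ be a squarefree integer. Let $n$ be a positive integer such that $a^{n+2} \equiv a \pmod{n}$ for all integers $a$ (i.e. $n \in C_{ -1}$), such that $n \equiv -1 \pmod{\frac{\lambda(|k|)}{\gcd(\lambda(|k|),|k|)}}$, and such that $\gcd(n,|k|)=1$. Then $|k|\,n \in C_k$, i.e. $a^{|k|n-k+1} \equiv a \pmod{|k|n}$ for all integers $a$.
   Context: For an integer $k$, $C_k$ denotes the set of integers $n>\max(k,0)$ such that $a^{n-k+1}\equiv a \pmod{n}$ for all integers $a$. $\lambda(m)$ denotes the Carmichael function: the greatest order of an element of $(\mathbb{Z}/m\mathbb{Z})^\times$ (with $\lambda(1)=1$). -}

module Defs where

open import Data.Nat as ℕ using (ℕ; zero; suc; _<_; _≤_)
open import Data.Nat.DivMod using (_/_)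
open import Data.Nat.GCD using (gcd)
open import Data.Nat.Primality using (Prime)
open import Data.Integer as ℤ using (ℤ; +_; ∣_∣)
open import Data.Integer.Divisibility as ℤd using ()
open import Data.Nat.Divisibility as ℕd using ()
open import Data.Product using (_×_; Σ)
open import Relation.Binary.PropositionalEquality using (_≡_)
open import Relation.Nullary using (¬_)

infix 4 _≡_[mod_]
_≡_[mod_] : ℤ → ℤ → ℤ → Set
a ≡ b [mod m ] = m ℤd.∣ (a ℤ.- b)

-- Membership in C_k : n > max(k,0) and a^(n-k+1) ≡ a (mod n) for all integers a.
-- (Since n > k, n - k + 1 ≥ 2, so taking ∣_∣ of the exponent is harmless.)
InC : ℤ → ℕ → Set
InC k n = (0 < n) × (k ℤ.< + n) ×
          (∀ (a : ℤ) → ((a ℤ.^ ∣ + n ℤ.- k ℤ.+ + 1 ∣) ≡ a [mod + n ]))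

SquareFree : ℤ → Set
SquareFree k = ∀ p → Prime p → ¬ (p ℕ.* p ℕd.∣ ∣ k ∣)

Unit : ℕ → ℕ → Set
Unit m a = gcd a m ≡ 1

IsOrder : ℕ → ℕ → ℕ → Set
IsOrder m a e = (0 < e) × ((+ a) ℤ.^ e ≡ + 1 [mod + m ]) ×
                (∀ e′ → 0 < e′ → e′ < e → ¬ ((+ a) ℤ.^ e′ ≡ + 1 [mod + m ]))

-- L is the Carmichael function λ(m) (m ≥ 1): the greatest order of an element
-- of (ℤ/mℤ)ˣ, elements represented by residues a < m coprime to m.
IsCarmichael : ℕ → ℕ → Set
IsCarmichael m L =
  (Σ ℕ λ a → (a < m) × Unit m a × IsOrder m a L) ×
  (∀ a e → a < m → Unit m a → IsOrder m a e → e ≤ L)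

_div_ : ℕ → ℕ → ℕ
a div zero = zero
a div suc b = a / suc b

module Submission where

-- Write M = |k| and N = M (n + 1), so that the exponent |k| n - k + 1 is N + 1.
-- Modulo n, iterating a^(n+2) ≡ a gives a^(1 + t (n+1)) ≡ a for every t.
-- Modulo M, the hypothesis on n gives λ(M) ∣ N.  Put d = gcd(a, M) and M = d M′;
-- as M is squarefree, d and M′ are coprime.  Both sides of a^(N+1) ≡ a vanish
-- modulo d, and modulo M′ the residue a agrees with the unit a + M′ of ℤ/M,
-- whose order divides λ(M), hence N.  As gcd(n, M) = 1 the two congruences
-- combine modulo M n.

open import Data.Product using (∃; ∃₂; _×_; _,_)
open import Function using (_∘_)
open import Relation.Binary.PropositionalEquality
open import Relation.Nullary using (¬_; Dec; yes; no; contradiction)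

open import Defs

-- Coprimality and prime powers

module _ where
  open import Data.Nat
  open import Data.Nat.Properties
  open import Data.Nat.Divisibility
  open import Data.Nat.Coprimality using (Coprime; coprime-divisor; coprime⇒gcd≡1) renaming (sym to Coprime-sym)
  open import Data.Nat.LCM using (lcm; lcm-least; gcd*lcm)
  open import Data.Nat.Primality using (Prime; prime⇒irreducible; prime⇒nonTrivial)
  open import Data.Nat.Primality.Factorisation using (factorise)
  open import Data.List using ([]; _∷_)
  open import Data.List.Relation.Unary.All using (_∷_)
  open import Data.Sum using (inj₁; inj₂)
  open import Induction.WellFounded using (Acc; acc)
  open import Data.Nat.Induction using (<-wellFounded)

  private variable a b c d e m n o q : ℕ

  coprime-*ʳ : Coprime a b → Coprime a c → Coprime a (b * c)
  coprime-*ʳ a⊥b a⊥c (d∣a , d∣bc) =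
    a⊥c (d∣a , coprime-divisor (λ (d′∣d , d′∣b) → a⊥b (∣-trans d′∣d d∣a , d′∣b)) d∣bc)

  coprime-^ʳ : ∀ n → Coprime a b → Coprime a (b ^ n)
  coprime-^ʳ zero    _   (_ , d∣1) = ∣1⇒≡1 d∣1
  coprime-^ʳ (suc n) a⊥b = coprime-*ʳ a⊥b (coprime-^ʳ n a⊥b)

  coprime⇒*∣ : Coprime m n → m ∣ o → n ∣ o → m * n ∣ o
  coprime⇒*∣ {m} {n} m⊥n m∣o n∣o = subst (_∣ _) lcm≡* (lcm-least m∣o n∣o)
    where
    lcm≡* : lcm m n ≡ m * n
    lcm≡* = trans (sym (*-identityˡ (lcm m n)))
                  (trans (cong (_* lcm m n) (sym (coprime⇒gcd≡1 m⊥n))) (gcd*lcm m n))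

  ∤⇒coprime : Prime q → ¬ q ∣ a → Coprime a q
  ∤⇒coprime q-prime q∤a (d∣a , d∣q) with prime⇒irreducible q-prime d∣q
  ... | inj₁ d≡1    = d≡1
  ... | inj₂ refl   = contradiction d∣a q∤a

  prime-factor : ∀ n → 1 < n → ∃ λ p → Prime p × p ∣ n
  prime-factor n@(suc _) 1<n with factorise n
  ... | record { factors = [] ; isFactorisation = n≡1 } = contradiction n≡1 (>⇒≢ 1<n)
  ... | record { factors = p ∷ _ ; isFactorisation = n≡p*ps ; factorsPrime = p-prime ∷ _ } =
    p , p-prime , subst (p ∣_) (sym n≡p*ps) (m∣m*n _)

  squarefree⇒coprime : (∀ p → Prime p → ¬ p * p ∣ m) → .{{NonZero m}} → d * e ≡ m → Coprime d e
  squarefree⇒coprime {m} _  de≡m {zero} (0∣d , _) =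
    contradiction (trans (sym de≡m) (cong (_* _) (0∣⇒≡0 0∣d))) (≢-nonZero⁻¹ m)
  squarefree⇒coprime _ _ {suc zero} _ = refl
  squarefree⇒coprime squarefree de≡m {c@(suc (suc _))} (c∣d , c∣e)
    with p , p-prime , p∣c ← prime-factor c (s≤s (s≤s z≤n)) =
    contradiction (subst (_ ∣_) de≡m (*-pres-∣ (∣-trans p∣c c∣d) (∣-trans p∣c c∣e)))
                  (squarefree p p-prime)

  coprime[d*e,x+e] : ∀ {x} → Coprime d e → d ∣ x → Coprime x e → Coprime (d * e) (x + e)
  coprime[d*e,x+e] {d} {e} {x} d⊥e d∣x x⊥e =
    Coprime-sym (coprime-*ʳ x+e⊥d x+e⊥e)
    where
    x+e⊥d : Coprime (x + e) d
    x+e⊥d (c∣x+e , c∣d) = d⊥e (c∣d , ∣m+n∣m⇒∣n c∣x+e (∣-trans c∣d d∣x))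
    x+e⊥e : Coprime (x + e) e
    x+e⊥e {c} (c∣x+e , c∣e) = x⊥e (∣m+n∣m⇒∣n (subst (c ∣_) (+-comm x e) c∣x+e) c∣e , c∣e)

  div∣⇒∣* : ∀ {L g M} o .{{_ : NonZero M}} → g ∣ L → g ∣ M → L div g ∣ o → L ∣ M * o
  div∣⇒∣* {g = zero} o 0∣L 0∣M _ = contradiction (0∣⇒≡0 0∣M) (≢-nonZero⁻¹ _)
  div∣⇒∣* {L} {g@(suc _)} o g∣L g∣M L/g∣o =
    ∣-trans (subst (L ∣_) (*-comm o g) (m/n∣o⇒m∣o*n g∣L L/g∣o)) (*-monoˡ-∣ o g∣M)

  prime⇒1< : Prime q → 1 < q
  prime⇒1< {q} q-prime = nonTrivial⇒n>1 q {{prime⇒nonTrivial q-prime}}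

  ^-monoʳ-∣ : ∀ q {s r} → s ≤ r → q ^ s ∣ q ^ r
  ^-monoʳ-∣ q {s} {r} s≤r =
    subst (q ^ s ∣_) (trans (sym (^-distribˡ-+-* q s (r ∸ s))) (cong (q ^_) (m+[n∸m]≡n s≤r))) (m∣m*n _)

  prime-power-split : 1 < q → ∀ n → .{{NonZero n}} → ∃₂ λ r n′ → n ≡ q ^ r * n′ × ¬ q ∣ n′
  prime-power-split {q} 1<q n = go n (<-wellFounded n)
    where
    go : ∀ n → Acc _<_ n → .{{NonZero n}} → ∃₂ λ r n′ → n ≡ q ^ r * n′ × ¬ q ∣ n′
    go n (acc rec) with q ∣? n
    ... | no q∤n = 0 , n , sym (*-identityˡ n) , q∤n
    ... | yes (divides zero n≡0) = contradiction n≡0 (≢-nonZero⁻¹ n)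
    ... | yes (divides n′@(suc _) n≡n′q)
      with r , n″ , n′≡qʳn″ , q∤n″ ← go n′ (rec (subst (n′ <_) (sym n≡n′q) (m<m*n n′ q 1<q))) =
      suc r , n″ , n≡qʳ⁺¹n″ , q∤n″
      where
      n≡qʳ⁺¹n″ : n ≡ q ^ suc r * n″
      n≡qʳ⁺¹n″ = begin
        n                  ≡⟨ n≡n′q ⟩
        n′ * q             ≡⟨ cong (_* q) n′≡qʳn″ ⟩
        q ^ r * n″ * q     ≡⟨ *-comm (q ^ r * n″) q ⟩
        q * (q ^ r * n″)   ≡⟨ *-assoc q (q ^ r) n″ ⟨
        q ^ suc r * n″     ∎
        where open ≡-Reasoning

  ∤⇒prime-power-∤ : ∀ {L} e → .{{NonZero e}} → ¬ e ∣ L →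
                     ∃₂ λ q s → Prime q × q ^ s ∣ e × ¬ q ^ s ∣ L
  ∤⇒prime-power-∤ {L} e = go e (<-wellFounded e)
    where
    go : ∀ e → Acc _<_ e → .{{NonZero e}} → ¬ e ∣ L → ∃₂ λ q s → Prime q × q ^ s ∣ e × ¬ q ^ s ∣ L
    go (suc zero) _ 1∤L = contradiction (1∣ L) 1∤L
    go e@(suc (suc _)) (acc rec) e∤L
      with q , q-prime , q∣e ← prime-factor e (s≤s (s≤s z≤n))
      with prime-power-split (prime⇒1< q-prime) e
    ... | zero , e′ , e≡e′ , q∤e′ =
      contradiction (subst (q ∣_) (trans e≡e′ (*-identityˡ e′)) q∣e) q∤e′
    ... | s@(suc _) , e′ , e≡qˢe′ , q∤e′ with q ^ s ∣? L
    ...   | no qˢ∤L = q , s , q-prime , divides e′ (trans e≡qˢe′ (*-comm (q ^ s) e′)) , qˢ∤L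
    ...   | yes qˢ∣L =
      let q′ , s′ , q′-prime , q′ˢ′∣e′ , q′ˢ′∤L = go e′ (rec e′<e) {{e′≢0}} e′∤L
      in q′ , s′ , q′-prime , ∣-trans q′ˢ′∣e′ (divides (q ^ s) e≡qˢe′) , q′ˢ′∤L
      where
      e′≢0 : NonZero e′
      e′≢0 = ≢-nonZero λ { refl → ≢-nonZero⁻¹ e (trans e≡qˢe′ (*-zeroʳ (q ^ s))) }
      e′<e : e′ < e
      e′<e = subst (e′ <_) (trans (*-comm e′ (q ^ s)) (sym e≡qˢe′))
                   (m<m*n e′ (q ^ s) {{e′≢0}} (^-monoʳ-< q (prime⇒1< q-prime) {0} {s} (s≤s z≤n)))
      e′∤L : ¬ e′ ∣ L
      e′∤L e′∣L = e∤L (subst (_∣ L) (sym e≡qˢe′)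
        (coprime⇒*∣ (Coprime-sym (coprime-^ʳ s (∤⇒coprime q-prime q∤e′))) qˢ∣L e′∣L))

-- Congruences of integers

module _ where
  open import Data.Nat as ℕ using (ℕ; zero; suc; NonZero)
  import Data.Nat.Divisibility as ℕ
  import Data.Nat.Properties as ℕ
  open import Data.Nat.Coprimality using (Coprime; coprime-divisor)
  open import Data.Integer using (ℤ; +_; _+_; _-_; -_; _*_; _^_; ∣_∣; _%ℕ_; _/ℕ_)
  open import Data.Integer.Properties
    using (+-inverseʳ; +-identityʳ; pos-*; pos-+; *-identityʳ; *-comm; abs-*; ^-distribˡ-+-*)
  open import Data.Integer.Divisibility.Signed
    using (_∣_; divides; ∣ᵤ⇒∣; ∣⇒∣ᵤ; ∣-trans; ∣m∣n⇒∣m+n; ∣m∣n⇒∣m-n; ∣m⇒∣-m; ∣n⇒∣m*n; ∣m⇒∣m*n)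
  open import Data.Integer.DivMod using (a≡a%ℕn+[a/ℕn]*n)
  open import Data.Integer.Tactic.RingSolver using (solve-∀)
  open import Level using (0ℓ)
  open import Relation.Nullary.Decidable using (map′)
  open import Relation.Binary.Bundles using (Setoid)
  import Relation.Binary.Reasoning.Setoid as SetoidReasoning

  -- Wrapping the congruence of Defs in a record keeps a and b visible to unification.
  infix 4 _≈_[mod_]
  record _≈_[mod_] (a b m : ℤ) : Set where
    constructor fromMod
    field toMod : a ≡ b [mod m ]
  open _≈_[mod_] public

  private variable
    a b c d m : ℤ

  private
    ∣⇒≈ : m ∣ (a - b) → a ≈ b [mod m ]
    ∣⇒≈ = fromMod ∘ ∣⇒∣ᵤ

    ≈⇒∣ : a ≈ b [mod m ] → m ∣ (a - b)
    ≈⇒∣ = ∣ᵤ⇒∣ ∘ toMod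

  ≈-reflexive : a ≡ b → a ≈ b [mod m ]
  ≈-reflexive {a} refl = fromMod (subst (λ z → _ ℕ.∣ ∣ z ∣) (sym (+-inverseʳ a)) (_ ℕ.∣0))

  ≈-refl : a ≈ a [mod m ]
  ≈-refl = ≈-reflexive refl

  ≈-sym : a ≈ b [mod m ] → b ≈ a [mod m ]
  ≈-sym {a = a} {b} a≈b = ∣⇒≈ (subst (_ ∣_) (negate a b) (∣m⇒∣-m (≈⇒∣ a≈b)))
    where negate : ∀ a b → - (a - b) ≡ b - a
          negate = solve-∀

  ≈-trans : a ≈ b [mod m ] → b ≈ c [mod m ] → a ≈ c [mod m ]
  ≈-trans {a = a} {b} {c = c} a≈b b≈c =
    ∣⇒≈ (subst (_ ∣_) (telescope a b c) (∣m∣n⇒∣m+n (≈⇒∣ a≈b) (≈⇒∣ b≈c)))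
    where telescope : ∀ a b c → (a - b) + (b - c) ≡ a - c
          telescope = solve-∀

  *-cong : a ≈ b [mod m ] → c ≈ d [mod m ] → a * c ≈ b * d [mod m ]
  *-cong {a = a} {b} {c = c} {d} a≈b c≈d =
    ∣⇒≈ (subst (_ ∣_) (expand a b c d) (∣m∣n⇒∣m+n (∣n⇒∣m*n a (≈⇒∣ c≈d)) (∣m⇒∣m*n d (≈⇒∣ a≈b))))
    where expand : ∀ a b c d → a * (c - d) + (a - b) * d ≡ a * c - b * d
          expand = solve-∀

  *-congˡ : ∀ c → a ≈ b [mod m ] → c * a ≈ c * b [mod m ]
  *-congˡ c = *-cong (≈-refl {a = c})

  ≈-dec : ∀ a b m → Dec (a ≈ b [mod m ])
  ≈-dec a b m = map′ fromMod toMod (∣ m ∣ ℕ.∣? ∣ a - b ∣)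

  ≈1⇒coprime : ∀ {n k} → + k * a ≈ + 1 [mod + n ] → Coprime n k
  ≈1⇒coprime {a} {n} {k} ka≈1 (d∣n , d∣k) = ℕ.∣1⇒≡1 (∣⇒∣ᵤ d∣1)
    where
    cancel : ∀ x → x - (x - + 1) ≡ + 1
    cancel = solve-∀
    d∣1 : + _ ∣ + 1
    d∣1 = subst (+ _ ∣_) (cancel (+ k * a))
            (∣m∣n⇒∣m-n (∣m⇒∣m*n {m = + k} a (∣ᵤ⇒∣ d∣k))
                       (∣-trans (∣ᵤ⇒∣ d∣n) (≈⇒∣ ka≈1)))

  ≈-setoid : ℤ → Setoid 0ℓ 0ℓ
  ≈-setoid m = record
    { _≈_           = λ a b → a ≈ b [mod m ]
    ; isEquivalence = record { refl = ≈-refl ; sym = ≈-sym ; trans = ≈-trans }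
    }

  module ≈-Reasoning {m : ℤ} = SetoidReasoning (≈-setoid m)

  ^-cong : ∀ n → a ≈ b [mod m ] → a ^ n ≈ b ^ n [mod m ]
  ^-cong zero    _   = ≈-refl
  ^-cong (suc n) a≈b = *-cong a≈b (^-cong n a≈b)

  ∣⇒≈0 : ∀ {n k} → n ℕ.∣ k → + k ≈ + 0 [mod + n ]
  ∣⇒≈0 {n} {k} n∣k = fromMod (subst (λ z → n ℕ.∣ ∣ z ∣) (sym (+-identityʳ (+ k))) n∣k)

  +-modulus≈ : ∀ x n → + (x ℕ.+ n) ≈ + x [mod + n ]
  +-modulus≈ x n = fromMod (subst (λ z → n ℕ.∣ ∣ z ∣) (sym difference) ℕ.∣-refl)
    where
    cancel : ∀ a b → a + b - a ≡ b
    cancel = solve-∀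
    difference : + (x ℕ.+ n) - + x ≡ + n
    difference = trans (cong (_- + x) (pos-+ x n)) (cancel (+ x) (+ n))

  ≈-mod-divisor : ∀ {d n} → d ℕ.∣ n → a ≈ b [mod + n ] → a ≈ b [mod + d ]
  ≈-mod-divisor d∣n a≈b = fromMod (ℕ.∣-trans d∣n (toMod a≈b))

  ≈-mod-coprime-* : ∀ {k n} → Coprime k n → a ≈ b [mod + k ] → a ≈ b [mod + n ] → a ≈ b [mod + (k ℕ.* n) ]
  ≈-mod-coprime-* k⊥n a≈b[k] a≈b[n] = fromMod (coprime⇒*∣ k⊥n (toMod a≈b[k]) (toMod a≈b[n]))

  %ℕ-≈ : ∀ a n .{{_ : NonZero n}} → + (a %ℕ n) ≈ a [mod + n ]
  %ℕ-≈ a n = ∣⇒≈ (divides (- (a /ℕ n)) (difference (a≡a%ℕn+[a/ℕn]*n a n)))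
    where
    remainder : ∀ r q n → r - (r + q * n) ≡ - q * n
    remainder = solve-∀
    difference : a ≡ + (a %ℕ n) + (a /ℕ n) * + n → + (a %ℕ n) - a ≡ - (a /ℕ n) * + n
    difference eq = trans (cong (_-_ (+ (a %ℕ n))) eq) (remainder (+ (a %ℕ n)) (a /ℕ n) (+ n))

  ≈-cancelˡ : ∀ {n k} → Coprime n k → + k * a ≈ + k * b [mod + n ] → a ≈ b [mod + n ]
  ≈-cancelˡ {a} {b} {n} {k} n⊥k ka≈kb = fromMod (coprime-divisor n⊥k n∣k∣a-b∣)
    where
    factor : ∀ k a b → k * a - k * b ≡ k * (a - b)
    factor = solve-∀
    n∣k∣a-b∣ : n ℕ.∣ k ℕ.* ∣ a - b ∣
    n∣k∣a-b∣ = subst (n ℕ.∣_) (trans (cong ∣_∣ (factor (+ k) a b)) (abs-* (+ k) (a - b))) (toMod ka≈kb)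

  ^-distribʳ-* : ∀ a b n → (a * b) ^ n ≡ a ^ n * b ^ n
  ^-distribʳ-* a b zero    = refl
  ^-distribʳ-* a b (suc n) = trans (cong (a * b *_) (^-distribʳ-* a b n)) (interchange a b (a ^ n) (b ^ n))
    where interchange : ∀ a b c d → a * b * (c * d) ≡ a * c * (b * d)
          interchange = solve-∀

  pos-^ : ∀ x n → + (x ℕ.^ n) ≡ (+ x) ^ n
  pos-^ x zero    = refl
  pos-^ x (suc n) = trans (pos-* x (x ℕ.^ n)) (cong (+ x *_) (pos-^ x n))

  ^-period : ∀ p → (∀ a → a ^ suc p ≈ a [mod m ]) → ∀ t a → a ^ suc (t ℕ.* p) ≈ a [mod m ]
  ^-period p fermat zero    a = ≈-reflexive (*-identityʳ a)
  ^-period p fermat (suc t) a = begin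
    a ^ suc (p ℕ.+ t ℕ.* p)      ≡⟨ cong (a ^_) (sym (ℕ.+-suc p (t ℕ.* p))) ⟩
    a ^ (p ℕ.+ suc (t ℕ.* p))    ≡⟨ ^-distribˡ-+-* a p (suc (t ℕ.* p)) ⟩
    a ^ p * a ^ suc (t ℕ.* p)    ≈⟨ *-congˡ (a ^ p) (^-period p fermat t a) ⟩
    a ^ p * a                    ≡⟨ *-comm (a ^ p) a ⟩
    a ^ suc p                    ≈⟨ fermat a ⟩
    a                            ∎
    where open ≈-Reasoning

-- Multiplicative orders

module _ where
  open import Data.Nat as ℕ using (ℕ; zero; suc; _<_; NonZero; z≤n; s≤s)
  import Data.Nat.Properties as ℕ
  open import Data.Nat.DivMod using (_%_; _/_; m≡m%n+[m/n]*n; m%n<n)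
  open import Data.Nat.Divisibility
    using (_∣_; _∣?_; divides; m%n≡0⇒n∣m; ∣⇒≤; ∣-trans; n∣m*n; m∣m*n; *-cancelˡ-∣)
  open import Data.Nat.Coprimality using (Coprime; coprime-divisor; coprime⇒gcd≡1) renaming (sym to Coprime-sym)
  open import Data.Integer using (ℤ; +_; _*_; _^_; _%ℕ_)
  import Data.Integer.Properties as ℤ
  open import Data.Integer.DivMod using (n%ℕd<d)
  open import Data.Nat.GCD using (gcd; gcd[m,n]∣m; gcd[m,n]∣n; gcd-greatest)
  open import Data.Nat.Primality using (Prime)
  open import Data.Fin using (Fin; toℕ; fromℕ<)
  open import Data.Fin.Properties using (pigeonhole; toℕ-fromℕ<)
  open import Induction.WellFounded using (Acc; acc)
  open import Data.Nat.Induction using (<-wellFounded)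
  open import Relation.Nullary.Decidable using (_×-dec_)

  -- The order characterised by divisibility; IsOrder of Defs characterises it by minimality.
  infix 4 _HasOrder_[mod_]
  record _HasOrder_[mod_] (x : ℤ) (u : ℕ) (m : ℤ) : Set where
    field
      order>0  : 0 < u
      ^order≈1 : x ^ u ≈ + 1 [mod m ]
      order∣   : ∀ {f} → x ^ f ≈ + 1 [mod m ] → u ∣ f
  open _HasOrder_[mod_]

  private variable
    x y m : ℤ
    u v : ℕ

  ^-multiple≈1 : ∀ x u {f} → x ^ u ≈ + 1 [mod m ] → u ∣ f → x ^ f ≈ + 1 [mod m ]
  ^-multiple≈1 x u {f} xᵘ≈1 (divides q f≡qu) = begin
    x ^ f          ≡⟨ cong (x ^_) (trans f≡qu (ℕ.*-comm q u)) ⟩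
    x ^ (u ℕ.* q)  ≡⟨ ℤ.^-*-assoc x u q ⟨
    (x ^ u) ^ q    ≈⟨ ^-cong q xᵘ≈1 ⟩
    (+ 1) ^ q      ≡⟨ ℤ.^-zeroˡ q ⟩
    + 1            ∎
    where open ≈-Reasoning

  hasOrder⇒^≈1 : ∀ {f} → x HasOrder u [mod m ] → u ∣ f → x ^ f ≈ + 1 [mod m ]
  hasOrder⇒^≈1 {x} {u} order = ^-multiple≈1 x u (^order≈1 order)

  minimal⇒hasOrder : 0 < u → x ^ u ≈ + 1 [mod m ] →
                     (∀ e → 0 < e → e < u → ¬ x ^ e ≈ + 1 [mod m ]) → x HasOrder u [mod m ]
  minimal⇒hasOrder {u} {x} {m} u>0 xᵘ≈1 minimal = record { order>0 = u>0 ; ^order≈1 = xᵘ≈1 ; order∣ = u∣ }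
    where
    instance _ = ℕ.>-nonZero u>0
    u∣ : ∀ {f} → x ^ f ≈ + 1 [mod m ] → u ∣ f
    u∣ {f} xᶠ≈1 with f % u in f%u≡r
    ... | zero  = m%n≡0⇒n∣m f u f%u≡r
    ... | suc r = contradiction xʳ≈1 (minimal (suc r) (s≤s z≤n) (subst (_< u) f%u≡r (m%n<n f u)))
      where
      f≡r+qu : f ≡ suc r ℕ.+ f / u ℕ.* u
      f≡r+qu = trans (m≡m%n+[m/n]*n f u) (cong (ℕ._+ f / u ℕ.* u) f%u≡r)
      xʳ≈1 : x ^ suc r ≈ + 1 [mod m ]
      xʳ≈1 = begin
        x ^ suc r                          ≡⟨ ℤ.*-identityʳ (x ^ suc r) ⟨
        x ^ suc r * + 1                    ≈⟨ *-congˡ (x ^ suc r) (^-multiple≈1 x u xᵘ≈1 (n∣m*n (f / u))) ⟨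
        x ^ suc r * x ^ (f / u ℕ.* u)      ≡⟨ ℤ.^-distribˡ-+-* x (suc r) (f / u ℕ.* u) ⟨
        x ^ (suc r ℕ.+ f / u ℕ.* u)        ≡⟨ cong (x ^_) f≡r+qu ⟨
        x ^ f                              ≈⟨ xᶠ≈1 ⟩
        + 1                                ∎
        where open ≈-Reasoning

  isOrder⇒hasOrder : ∀ {n a} → IsOrder n a u → (+ a) HasOrder u [mod + n ]
  isOrder⇒hasOrder (u>0 , aᵘ≡1 , minimal) =
    minimal⇒hasOrder u>0 (fromMod aᵘ≡1) (λ e e>0 e<u aᵉ≈1 → minimal e e>0 e<u (toMod aᵉ≈1))

  hasOrder⇒isOrder : ∀ {n a} → (+ a) HasOrder u [mod + n ] → IsOrder n a u
  hasOrder⇒isOrder order = order>0 order , toMod (^order≈1 order) ,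
    λ e e>0 e<u aᵉ≡1 → ℕ.<⇒≱ e<u (∣⇒≤ {{ℕ.>-nonZero e>0}} (order∣ order (fromMod aᵉ≡1)))

  hasOrder-cong : x ≈ y [mod m ] → x HasOrder u [mod m ] → y HasOrder u [mod m ]
  hasOrder-cong {u = u} x≈y order = record
    { order>0  = order>0 order
    ; ^order≈1 = ≈-trans (^-cong u (≈-sym x≈y)) (^order≈1 order)
    ; order∣   = λ {f} yᶠ≈1 → order∣ order (≈-trans (^-cong f x≈y) yᶠ≈1)
    }

  hasOrder-^ : ∀ d {w} → x HasOrder (d ℕ.* w) [mod m ] → (x ^ d) HasOrder w [mod m ]
  hasOrder-^ {x} d {w} order = record
    { order>0  = ℕ.>-nonZero⁻¹ w {{ℕ.m*n≢0⇒n≢0 d}}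
    ; ^order≈1 = subst (_≈ + 1 [mod _ ]) (sym (ℤ.^-*-assoc x d w)) (^order≈1 order)
    ; order∣   = λ {f} xᵈᶠ≈1 →
        *-cancelˡ-∣ d {{ℕ.m*n≢0⇒m≢0 d}}
          (order∣ order (subst (_≈ + 1 [mod _ ]) (ℤ.^-*-assoc x d f) xᵈᶠ≈1))
    }
    where instance _ = ℕ.>-nonZero (order>0 order)

  ^≈1-cancelʳ : ∀ g → (x * y) ^ g ≈ + 1 [mod m ] → y ^ g ≈ + 1 [mod m ] → x ^ g ≈ + 1 [mod m ]
  ^≈1-cancelʳ {x} {y} g xyᵍ≈1 yᵍ≈1 = begin
    x ^ g            ≡⟨ ℤ.*-identityʳ (x ^ g) ⟨
    x ^ g * + 1      ≈⟨ *-congˡ (x ^ g) yᵍ≈1 ⟨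
    x ^ g * y ^ g    ≡⟨ ^-distribʳ-* x y g ⟨
    (x * y) ^ g      ≈⟨ xyᵍ≈1 ⟩
    + 1              ∎
    where open ≈-Reasoning

  coprime-order∣ : ∀ {f} → x HasOrder u [mod m ] → y HasOrder v [mod m ] → Coprime u v →
                   (x * y) ^ f ≈ + 1 [mod m ] → u ∣ f
  coprime-order∣ {x} {y = y} {v} {f} x-order y-order u⊥v xyᶠ≈1 = coprime-divisor u⊥v (order∣ x-order xᵛᶠ≈1)
    where
    xᵛᶠ≈1 : x ^ (v ℕ.* f) ≈ + 1 [mod _ ]
    xᵛᶠ≈1 = ^≈1-cancelʳ (v ℕ.* f) (^-multiple≈1 (x * y) f xyᶠ≈1 (n∣m*n v))
                                   (hasOrder⇒^≈1 y-order (m∣m*n f))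

  hasOrder-* : x HasOrder u [mod m ] → y HasOrder v [mod m ] → Coprime u v →
               (x * y) HasOrder (u ℕ.* v) [mod m ]
  hasOrder-* {x} {u} {m} {y} {v} x-order y-order u⊥v = record
    { order>0  = ℕ.*-mono-< (order>0 x-order) (order>0 y-order)
    ; ^order≈1 = begin
        (x * y) ^ (u ℕ.* v)                ≡⟨ ^-distribʳ-* x y (u ℕ.* v) ⟩
        x ^ (u ℕ.* v) * y ^ (u ℕ.* v)      ≈⟨ *-cong (hasOrder⇒^≈1 x-order (m∣m*n v))
                                                     (hasOrder⇒^≈1 y-order (n∣m*n u)) ⟩
        + 1                                ∎
    ; order∣   = λ {f} xyᶠ≈1 → coprime⇒*∣ u⊥v
        (coprime-order∣ x-order y-order u⊥v xyᶠ≈1)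
        (coprime-order∣ y-order x-order (Coprime-sym u⊥v)
                        (subst (λ z → z ^ f ≈ + 1 [mod m ]) (ℤ.*-comm x y) xyᶠ≈1))
    }
    where open ≈-Reasoning

  ^-collision : ∀ {n} .{{_ : NonZero n}} x → ∃₂ λ i j → i < j × x ^ i ≈ x ^ j [mod + n ]
  ^-collision {n} x =
    let i , j , i<j , rᵢ≡rⱼ = pigeonhole (ℕ.n<1+n n) residue
    in toℕ i , toℕ j , i<j , same-residue i j rᵢ≡rⱼ
    where
    residue : Fin (suc n) → Fin n
    residue i = fromℕ< (n%ℕd<d (x ^ toℕ i) n)
    same-residue : ∀ i j → residue i ≡ residue j → x ^ toℕ i ≈ x ^ toℕ j [mod + n ]
    same-residue i j rᵢ≡rⱼ = begin
      x ^ toℕ i                   ≈⟨ %ℕ-≈ (x ^ toℕ i) n ⟨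
      + (x ^ toℕ i %ℕ n)          ≡⟨ cong +_ (toℕ-fromℕ< (n%ℕd<d (x ^ toℕ i) n)) ⟨
      + toℕ (residue i)           ≡⟨ cong (+_ ∘ toℕ) rᵢ≡rⱼ ⟩
      + toℕ (residue j)           ≡⟨ cong +_ (toℕ-fromℕ< (n%ℕd<d (x ^ toℕ j) n)) ⟩
      + (x ^ toℕ j %ℕ n)          ≈⟨ %ℕ-≈ (x ^ toℕ j) n ⟩
      x ^ toℕ j                   ∎
      where open ≈-Reasoning

  coprime⇒period : ∀ {n} .{{_ : NonZero n}} {x} → Coprime n x → ∃ λ D → 0 < D × (+ x) ^ D ≈ + 1 [mod + n ]
  coprime⇒period {n} {x} n⊥x =
    let i , j , i<j , xⁱ≈xʲ = ^-collision (+ x)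
    in j ℕ.∸ i , ℕ.m<n⇒0<n∸m i<j ,
       ≈-sym (≈-cancelˡ (coprime-^ʳ i n⊥x) (shift i j (ℕ.<⇒≤ i<j) xⁱ≈xʲ))
    where
    shift : ∀ i j → i ℕ.≤ j → (+ x) ^ i ≈ (+ x) ^ j [mod + n ] →
            + (x ℕ.^ i) * + 1 ≈ + (x ℕ.^ i) * (+ x) ^ (j ℕ.∸ i) [mod + n ]
    shift i j i≤j xⁱ≈xʲ = begin
      + (x ℕ.^ i) * + 1                    ≡⟨ ℤ.*-identityʳ _ ⟩
      + (x ℕ.^ i)                          ≡⟨ pos-^ x i ⟩
      (+ x) ^ i                            ≈⟨ xⁱ≈xʲ ⟩
      (+ x) ^ j                            ≡⟨ cong ((+ x) ^_) (ℕ.m+[n∸m]≡n i≤j) ⟨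
      (+ x) ^ (i ℕ.+ (j ℕ.∸ i))            ≡⟨ ℤ.^-distribˡ-+-* (+ x) i (j ℕ.∸ i) ⟩
      (+ x) ^ i * (+ x) ^ (j ℕ.∸ i)        ≡⟨ cong (_* (+ x) ^ (j ℕ.∸ i)) (pos-^ x i) ⟨
      + (x ℕ.^ i) * (+ x) ^ (j ℕ.∸ i)      ∎
      where open ≈-Reasoning

  period⇒hasOrder : ∀ D → 0 < D → x ^ D ≈ + 1 [mod m ] → ∃ λ u → x HasOrder u [mod m ]
  period⇒hasOrder {x} {m} D = go D (<-wellFounded D)
    where
    go : ∀ D → Acc _<_ D → 0 < D → x ^ D ≈ + 1 [mod m ] → ∃ λ u → x HasOrder u [mod m ]
    go D (acc rec) D>0 xᴰ≈1 with ℕ.anyUpTo? (λ e → (0 ℕ.<? e) ×-dec ≈-dec (x ^ e) (+ 1) m) D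
    ... | yes (e , e<D , e>0 , xᵉ≈1) = go e (rec e<D) e>0 xᵉ≈1
    ... | no ∄shorter = D , minimal⇒hasOrder D>0 xᴰ≈1 λ e e>0 e<D xᵉ≈1 → ∄shorter (e , e<D , e>0 , xᵉ≈1)

  coprime⇒hasOrder : ∀ {n} .{{_ : NonZero n}} {x} → Coprime n x → ∃ λ u → (+ x) HasOrder u [mod + n ]
  coprime⇒hasOrder n⊥x = let D , D>0 , xᴰ≈1 = coprime⇒period n⊥x in period⇒hasOrder D D>0 xᴰ≈1

  hasOrder⇒coprime : ∀ {n a} → (+ a) HasOrder u [mod + n ] → Coprime n a
  hasOrder⇒coprime {zero}  order = contradiction (order>0 order) λ ()
  hasOrder⇒coprime {suc _} order = ≈1⇒coprime (^order≈1 order)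

  -- If e ∤ λ(n), some q^s divides e but not λ(n) = q^r L′ with q ∤ L′; then
  -- g^(q^r) h^(e/q^s) has order L′ q^s > λ(n), contradicting maximality.
  carmichael-exponent : ∀ {n L h e} .{{_ : NonZero n}} → IsCarmichael n L →
                        (+ h) HasOrder e [mod + n ] → e ∣ L
  carmichael-exponent {n} {L} {h} {e} ((g , _ , _ , g-isOrder@(L>0 , _)) , maximal) h-order with e ∣? L
  ... | yes e∣L = e∣L
  ... | no e∤L
    with q , s , q-prime , divides e′ e≡e′qˢ , qˢ∤L
           ← ∤⇒prime-power-∤ e {{ℕ.>-nonZero (order>0 h-order)}} e∤L
    with r , L′ , L≡qʳL′ , q∤L′ ← prime-power-split (prime⇒1< q-prime) L {{ℕ.>-nonZero L>0}} =
    contradiction (maximal c (L′ ℕ.* q ℕ.^ s) c<n c-unit (hasOrder⇒isOrder c-order)) (ℕ.<⇒≱ L<L′qˢ)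
    where
    g′-order : ((+ g) ^ (q ℕ.^ r)) HasOrder L′ [mod + n ]
    g′-order = hasOrder-^ (q ℕ.^ r) (subst (_ HasOrder_[mod _ ]) L≡qʳL′ (isOrder⇒hasOrder g-isOrder))
    h′-order : ((+ h) ^ e′) HasOrder (q ℕ.^ s) [mod + n ]
    h′-order = hasOrder-^ e′ (subst (_ HasOrder_[mod _ ]) e≡e′qˢ h-order)
    gh : ℤ
    gh = (+ g) ^ (q ℕ.^ r) * (+ h) ^ e′
    c : ℕ
    c = gh %ℕ n
    c<n : c < n
    c<n = n%ℕd<d gh n
    c-order : (+ c) HasOrder (L′ ℕ.* q ℕ.^ s) [mod + n ]
    c-order = hasOrder-cong (≈-sym (%ℕ-≈ gh n))
                (hasOrder-* g′-order h′-order (coprime-^ʳ s (∤⇒coprime q-prime q∤L′)))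
    c-unit : Unit n c
    c-unit = coprime⇒gcd≡1 (Coprime-sym (hasOrder⇒coprime c-order))
    r<s : r < s
    r<s = ℕ.≰⇒> λ s≤r →
      qˢ∤L (∣-trans (^-monoʳ-∣ q s≤r) (divides L′ (trans L≡qʳL′ (ℕ.*-comm _ L′))))
    L′≢0 : NonZero L′
    L′≢0 = ℕ.m*n≢0⇒n≢0 (q ℕ.^ r) {{ℕ.>-nonZero (subst (0 <_) L≡qʳL′ L>0)}}
    L<L′qˢ : L < L′ ℕ.* q ℕ.^ s
    L<L′qˢ = subst (_< L′ ℕ.* q ℕ.^ s) (sym (trans L≡qʳL′ (ℕ.*-comm _ L′)))
               (ℕ.*-monoʳ-< L′ {{L′≢0}} (ℕ.^-monoʳ-< q (prime⇒1< q-prime) r<s))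

  squarefree-fermatℕ : ∀ {M L N} .{{_ : NonZero M}} → (∀ p → Prime p → ¬ p ℕ.* p ∣ M) →
                       IsCarmichael M L → L ∣ N → ∀ x → (+ x) ^ suc N ≈ + x [mod + M ]
  squarefree-fermatℕ {M} {L} {N} squarefree λ-M L∣N x with divides M′ M≡M′d ← gcd[m,n]∣n x M =
    subst (λ m → (+ x) ^ suc N ≈ + x [mod + m ]) (sym M≡dM′) (≈-mod-coprime-* d⊥M′ mod-d mod-M′)
    where
    d : ℕ
    d = gcd x M
    M≡dM′ : M ≡ d ℕ.* M′
    M≡dM′ = trans M≡M′d (ℕ.*-comm M′ d)
    d⊥M′ : Coprime d M′
    d⊥M′ = squarefree⇒coprime squarefree (sym M≡dM′)
    M′∣M : M′ ∣ M
    M′∣M = divides d M≡dM′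
    x⊥M′ : Coprime x M′
    x⊥M′ (c∣x , c∣M′) = d⊥M′ (gcd-greatest c∣x (∣-trans c∣M′ M′∣M) , c∣M′)
    xᴺ≈1 : (+ x) ^ N ≈ + 1 [mod + M′ ]
    xᴺ≈1 =
      let M⊥x+M′ = subst (λ m → Coprime m (x ℕ.+ M′)) (sym M≡dM′)
                         (coprime[d*e,x+e] d⊥M′ (gcd[m,n]∣m x M) x⊥M′)
          _ , order = coprime⇒hasOrder M⊥x+M′
      in ≈-trans (^-cong N (≈-sym (+-modulus≈ x M′)))
                 (≈-mod-divisor M′∣M (hasOrder⇒^≈1 order (∣-trans (carmichael-exponent λ-M order) L∣N)))
    mod-M′ : (+ x) ^ suc N ≈ + x [mod + M′ ]
    mod-M′ = begin
      + x * (+ x) ^ N   ≈⟨ *-congˡ (+ x) xᴺ≈1 ⟩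
      + x * + 1         ≡⟨ ℤ.*-identityʳ (+ x) ⟩
      + x               ∎
      where open ≈-Reasoning
    mod-d : (+ x) ^ suc N ≈ + x [mod + d ]
    mod-d = begin
      (+ x) ^ suc N     ≈⟨ ^-cong (suc N) x≈0 ⟩
      (+ 0) ^ suc N     ≡⟨ ℤ.*-zeroˡ ((+ 0) ^ N) ⟩
      + 0               ≈⟨ x≈0 ⟨
      + x               ∎
      where open ≈-Reasoning
            x≈0 : + x ≈ + 0 [mod + d ]
            x≈0 = ∣⇒≈0 (gcd[m,n]∣m x M)

  squarefree-fermat : ∀ {M L N} .{{_ : NonZero M}} → (∀ p → Prime p → ¬ p ℕ.* p ∣ M) →
                      IsCarmichael M L → L ∣ N → ∀ a → a ^ suc N ≈ a [mod + M ]
  squarefree-fermat {M} {L} {N} squarefree λ-M L∣N a = begin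
    a ^ suc N              ≈⟨ ^-cong (suc N) (%ℕ-≈ a M) ⟨
    (+ (a %ℕ M)) ^ suc N   ≈⟨ squarefree-fermatℕ squarefree λ-M L∣N (a %ℕ M) ⟩
    + (a %ℕ M)             ≈⟨ %ℕ-≈ a M ⟩
    a                      ∎
    where open ≈-Reasoning

open import Data.Nat using (ℕ; suc) renaming (_*_ to _*ℕ_)
import Data.Nat as ℕ
import Data.Nat.Properties as ℕ
import Data.Nat.Tactic.RingSolver as ℕ
open import Data.Nat.GCD using (gcd; gcd[m,n]∣m; gcd[m,n]∣n)
open import Data.Nat.Divisibility using (_∣_)
open import Data.Nat.Coprimality using (Coprime; gcd≡1⇒coprime) renaming (sym to Coprime-sym)
open import Data.Integer using (ℤ; +_; -[1+_]; -_; ∣_∣; _<_; +<+; -<+; _^_)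

proposition3p3 : (k : ℤ) → k < + 0 → SquareFree k →
    (n : ℕ) → InC (- + 1) n →
    (L : ℕ) → IsCarmichael ∣ k ∣ L →
    (L div gcd L ∣ k ∣) ∣ suc n →
    gcd n ∣ k ∣ ≡ 1 →
    InC k ((∣ k ∣ *ℕ n))
proposition3p3 (+ _)    (+<+ ())
proposition3p3 -[1+ j ] _ squarefree n (n>0 , _ , fermat-n) L λ-M λ′∣n+1 gcd[n,M]≡1 =
  ℕ.*-mono-< {0} {M} ℕ.z<s n>0 , -<+ , λ a →
    subst (λ e → a ^ e ≡ a [mod + (M *ℕ n) ]) (exponent M n)
          (toMod (≈-mod-coprime-* M⊥n (mod-M a) (mod-n a)))
  where
  M : ℕ
  M = suc j
  M⊥n : Coprime M n
  M⊥n = Coprime-sym (gcd≡1⇒coprime gcd[n,M]≡1)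
  mod-M : ∀ a → a ^ suc (M *ℕ suc n) ≈ a [mod + M ]
  mod-M = squarefree-fermat squarefree λ-M (div∣⇒∣* (suc n) (gcd[m,n]∣m L M) (gcd[m,n]∣n L M) λ′∣n+1)
  fermat-n′ : ∀ a → a ^ suc (suc n) ≈ a [mod + n ]
  fermat-n′ a =
    fromMod (subst (λ e → a ^ e ≡ a [mod + n ]) (trans (ℕ.+-assoc n 1 1) (ℕ.+-comm n 2)) (fermat-n a))
  mod-n : ∀ a → a ^ suc (M *ℕ suc n) ≈ a [mod + n ]
  mod-n = ^-period (suc n) fermat-n′ M
  exponent : ∀ m n → suc (m *ℕ suc n) ≡ m *ℕ n ℕ.+ m ℕ.+ 1
  exponent = ℕ.solve-∀
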